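{- Let $p\ge 2$ and let $G$ be a finite connected graph with no induced subgraph isomorphic to $pK_1+K_2$. Then $c(G)\le p+1$.
   Context: $pK_1+K_2$ is the disjoint union of $p$ isolated vertices and one edge. The cop number $c(G)$ is the minimum number of cops guaranteeing capture in the standard game of cops and robber (cops placed first, then robber; alternately each cop moves to an adjacent vertex or stays, then the robber moves to an adjacent vertex or stays; full information; capture when a cop occupies the robber's vertex). -}

module Defs where

open import Data.Nat using (ℕ; zero; suc; _+_)
open import Data.Fin using (Fin; zero; suc)
open import Data.Bool using (Bool; true; false)
open import Data.Product using (Σ; ∃; _×_; _,_)
open import Data.Sum using (_⊎_)
open import Function.Definitions using (Injective)
open import Relation.Binary.PropositionalEquality using (_≡_; refl)

record Graph (n : ℕ) : Set where
  field
    adj    : Fin n → Fin n → Bool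
    adj-sym : ∀ u v → adj u v ≡ adj v u
    adj-irrefl : ∀ v → adj v v ≡ false
open Graph public

data Walk {n : ℕ} (G : Graph n) : Fin n → Fin n → Set where
  [] : ∀ {u} → Walk G u u
  _∷_ : ∀ {u v w} → adj G u v ≡ true → Walk G v w → Walk G u w

record Connected {n : ℕ} (G : Graph n) : Set where
  field
    nonempty : Fin n
    walk : ∀ u v → Walk G u v

pK1+K2-adj : (p : ℕ) → Fin (2 + p) → Fin (2 + p) → Bool
pK1+K2-adj p zero (suc zero) = true
pK1+K2-adj p (suc zero) zero = true
pK1+K2-adj p _ _ = false

pK1+K2 : (p : ℕ) → Graph (2 + p)
pK1+K2 p = record { adj = pK1+K2-adj p ; adj-sym = sym' ; adj-irrefl = irr }
  where
  sym' : ∀ u v → pK1+K2-adj p u v ≡ pK1+K2-adj p v u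
  sym' zero zero = refl
  sym' zero (suc zero) = refl
  sym' zero (suc (suc v)) = refl
  sym' (suc zero) zero = refl
  sym' (suc zero) (suc zero) = refl
  sym' (suc zero) (suc (suc v)) = refl
  sym' (suc (suc u)) zero = refl
  sym' (suc (suc u)) (suc zero) = refl
  sym' (suc (suc u)) (suc (suc v)) = refl
  irr : ∀ v → pK1+K2-adj p v v ≡ false
  irr zero = refl
  irr (suc zero) = refl
  irr (suc (suc v)) = refl

InducedSubgraph : {m n : ℕ} → Graph m → Graph n → Set
InducedSubgraph {m} {n} H G =
  Σ (Fin m → Fin n) λ f → Injective _≡_ _≡_ f × (∀ i j → adj G (f i) (f j) ≡ adj H i j)

Move : {n : ℕ} → Graph n → Fin n → Fin n → Set
Move G u v = u ≡ v ⊎ adj G u v ≡ true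

Cops : ℕ → ℕ → Set
Cops n k = Fin k → Fin n

Caught : {n k : ℕ} → Cops n k → Fin n → Set
Caught c r = ∃ λ i → c i ≡ r

-- CopWin G c r : it is the cops' turn, cops at c, robber at r, and the cops
-- can force capture in finitely many moves (a well-founded strategy tree,
-- possibly depending on the whole history).
data CopWin {n k : ℕ} (G : Graph n) : Cops n k → Fin n → Set where
  caught : ∀ {c r} → Caught c r → CopWin G c r
  move   : ∀ {c r} (c' : Cops n k) → (∀ i → Move G (c i) (c' i)) →
           (Caught c' r ⊎ (∀ r' → Move G r r' → CopWin G c' r')) →
           CopWin G c r

-- k cops guarantee capture: cops place first, then the robber places,
-- then the cops move first.
CopsWin : {n : ℕ} → Graph n → ℕ → Set
CopsWin {n} G k = Σ (Cops n k) λ c → ∀ r → CopWin G c r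

CopNumber≤ : {n : ℕ} → Graph n → ℕ → Set
CopNumber≤ G k = CopsWin G k

-- Greedily choose up to p vertices forming an independent set. Either they
-- dominate G before p are chosen, or we reach p independent vertices; in the
-- latter case an edge avoiding their closed neighbourhood would induce
-- pK₁ + K₂. Either way every edge of G meets the closed neighbourhood N[C] of
-- the chosen set C. Put p cops on C and one chaser anywhere. A robber outside
-- N[C] cannot move without entering N[C], where a guard catches him at once,
-- so the chaser walks to him along any path.
module Submission where

open import Defs
open import Data.Nat using (ℕ; zero; suc; _+_; _≤_)
open import Data.Fin using (Fin; zero; suc; _≟_)
open import Data.Fin.Properties using (any?; all?; ¬∀⟶∃¬)
open import Data.Bool using (true; false)
open import Data.Bool.Properties using () renaming (_≟_ to _≟ᵇ_)
open import Data.Vec.Functional using (updateAt) renaming (_∷_ to _∷ᶠ_)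
open import Data.Vec.Functional.Properties using (updateAt-updates; updateAt-minimal)
open import Data.Product using (Σ; ∃; _×_; _,_)
open import Data.Sum using (_⊎_; inj₁; inj₂)
open import Data.Empty using (⊥-elim)
open import Function.Definitions using (Injective)
open import Relation.Nullary using (¬_; Dec; yes; no)
open import Relation.Nullary.Decidable using (_⊎-dec_)
open import Relation.Binary.PropositionalEquality
  using (_≡_; _≢_; refl; sym; trans; cong; subst)

module _ {n : ℕ} (G : Graph n) where

  _∈N[_] : ∀ {k} → Fin n → (Fin k → Fin n) → Set
  v ∈N[ L ] = ∃ λ i → Move G (L i) v

  _∈N[_]? : ∀ {k} v (L : Fin k → Fin n) → Dec (v ∈N[ L ])
  v ∈N[ L ]? = any? λ i → (L i ≟ v) ⊎-dec (adj G (L i) v ≟ᵇ true)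

  Dominating : ∀ {k} → (Fin k → Fin n) → Set
  Dominating L = ∀ v → v ∈N[ L ]

  Independent : ∀ {k} → (Fin k → Fin n) → Set
  Independent L = ∀ i j → adj G (L i) (L j) ≡ false

  EdgeDominating : ∀ {k} → (Fin k → Fin n) → Set
  EdgeDominating L = ∀ s t → adj G s t ≡ true → s ∈N[ L ] ⊎ t ∈N[ L ]

  adjacent⇒distinct : ∀ {s t} → adj G s t ≡ true → s ≢ t
  adjacent⇒distinct {s} st refl with () ← trans (sym st) (adj-irrefl G s)

  ∉N⇒nonadjacentʳ : ∀ {k} (L : Fin k → Fin n) {v} i → ¬ v ∈N[ L ] →
                    adj G (L i) v ≡ false
  ∉N⇒nonadjacentʳ L {v} i v∉ with adj G (L i) v in e
  ... | false = refl
  ... | true  = ⊥-elim (v∉ (i , inj₂ e))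

  ∉N⇒nonadjacentˡ : ∀ {k} (L : Fin k → Fin n) {v} i → ¬ v ∈N[ L ] →
                    adj G v (L i) ≡ false
  ∉N⇒nonadjacentˡ L {v} i v∉ = trans (adj-sym G v (L i)) (∉N⇒nonadjacentʳ L i v∉)

  ∷-injective : ∀ {k} {L : Fin k → Fin n} {v} → Injective _≡_ _≡_ L →
                ¬ v ∈N[ L ] → Injective _≡_ _≡_ (v ∷ᶠ L)
  ∷-injective inj v∉ {zero}  {zero}  _  = refl
  ∷-injective inj v∉ {zero}  {suc j} eq = ⊥-elim (v∉ (j , inj₁ (sym eq)))
  ∷-injective inj v∉ {suc i} {zero}  eq = ⊥-elim (v∉ (i , inj₁ eq))
  ∷-injective inj v∉ {suc i} {suc j} eq = cong suc (inj eq)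

  ∷-independent : ∀ {k} {L : Fin k → Fin n} {v} → Independent L →
                  ¬ v ∈N[ L ] → Independent (v ∷ᶠ L)
  ∷-independent {v = v} ind v∉ zero    zero    = adj-irrefl G v
  ∷-independent {L = L} ind v∉ zero    (suc j) = ∉N⇒nonadjacentˡ L j v∉
  ∷-independent {L = L} ind v∉ (suc i) zero    = ∉N⇒nonadjacentʳ L i v∉
  ∷-independent         ind v∉ (suc i) (suc j) = ind i j

  ∈N-∷ : ∀ {k} {L : Fin k → Fin n} {w} v → w ∈N[ L ] → w ∈N[ v ∷ᶠ L ]
  ∈N-∷ v (i , m) = suc i , m

  ∷-dominating : ∀ {k} {L : Fin k → Fin n} v → Dominating L → Dominating (v ∷ᶠ L)
  ∷-dominating v dom w = ∈N-∷ v (dom w)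

  induced-pK1+K2 : ∀ {p} (L : Fin p → Fin n) → Injective _≡_ _≡_ L → Independent L →
                   ∀ {s t} → ¬ s ∈N[ L ] → ¬ t ∈N[ L ] → adj G s t ≡ true →
                   InducedSubgraph (pK1+K2 p) G
  induced-pK1+K2 {p} L inj ind {s} {t} s∉ t∉ st = f , f-injective , f-adj
    where
    f : Fin (2 + p) → Fin n
    f = s ∷ᶠ t ∷ᶠ L

    f-injective : Injective _≡_ _≡_ f
    f-injective {zero}  {zero}  _  = refl
    f-injective {zero}  {suc j} eq with j
    ... | zero   = ⊥-elim (adjacent⇒distinct st eq)
    ... | suc j′ = ⊥-elim (s∉ (j′ , inj₁ (sym eq)))
    f-injective {suc i} {zero}  eq = sym (f-injective {zero} {suc i} (sym eq))
    f-injective {suc i} {suc j} eq = cong suc (∷-injective inj t∉ eq)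

    f-adj : ∀ i j → adj G (f i) (f j) ≡ adj (pK1+K2 p) i j
    f-adj zero          zero          = adj-irrefl G s
    f-adj zero          (suc zero)    = st
    f-adj zero          (suc (suc j)) = ∉N⇒nonadjacentˡ L j s∉
    f-adj (suc zero)    zero          = trans (adj-sym G t s) st
    f-adj (suc zero)    (suc zero)    = adj-irrefl G t
    f-adj (suc zero)    (suc (suc j)) = ∉N⇒nonadjacentˡ L j t∉
    f-adj (suc (suc i)) zero          = ∉N⇒nonadjacentʳ L i s∉
    f-adj (suc (suc i)) (suc zero)    = ∉N⇒nonadjacentʳ L i t∉
    f-adj (suc (suc i)) (suc (suc j)) = ind i j

  independent⇒edgeDominating : ∀ {p} → ¬ InducedSubgraph (pK1+K2 p) G →
    (L : Fin p → Fin n) → Injective _≡_ _≡_ L → Independent L → EdgeDominating L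
  independent⇒edgeDominating free L inj ind s t st with s ∈N[ L ]? | t ∈N[ L ]?
  ... | yes s∈ | _      = inj₁ s∈
  ... | no _   | yes t∈ = inj₂ t∈
  ... | no s∉  | no t∉  = ⊥-elim (free (induced-pK1+K2 L inj ind s∉ t∉ st))

  dominating⇒edgeDominating : ∀ {k} {L : Fin k → Fin n} → Dominating L → EdgeDominating L
  dominating⇒edgeDominating dom s t _ = inj₁ (dom s)

  independentOrDominating : Fin n → ∀ k →
    (Σ (Fin k → Fin n) λ L → Injective _≡_ _≡_ L × Independent L) ⊎
    (Σ (Fin k → Fin n) Dominating)
  independentOrDominating v zero    = inj₁ ((λ ()) , (λ {}) , (λ ()))
  independentOrDominating v (suc k) with independentOrDominating v k
  ... | inj₂ (L , dom) = inj₂ (v ∷ᶠ L , ∷-dominating v dom)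
  ... | inj₁ (L , inj , ind) with all? (_∈N[ L ]?)
  ...   | yes dom = inj₂ (v ∷ᶠ L , ∷-dominating v dom)
  ...   | no ¬dom with ¬∀⟶∃¬ n (_∈N[ L ]) (_∈N[ L ]?) ¬dom
  ...     | w , w∉ = inj₁ (w ∷ᶠ L , ∷-injective inj w∉ , ∷-independent ind w∉)

  edgeDominatingFamily : ∀ {p} → ¬ InducedSubgraph (pK1+K2 p) G → Fin n →
                         Σ (Fin p → Fin n) EdgeDominating
  edgeDominatingFamily {p} free v with independentOrDominating v p
  ... | inj₁ (L , inj , ind) = L , independent⇒edgeDominating free L inj ind
  ... | inj₂ (L , dom)       = L , dominating⇒edgeDominating dom

  capture-in-N : ∀ {k} (c : Cops n k) {r} → r ∈N[ c ] → CopWin G c r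
  capture-in-N c {r} (i , ci→r) =
    move c′ c→c′ (inj₁ (i , updateAt-updates i c))
    where
    c′ : Cops n _
    c′ = updateAt c i λ _ → r

    c→c′ : ∀ j → Move G (c j) (c′ j)
    c→c′ j with j ≟ i
    ... | yes refl = subst (Move G (c i)) (sym (updateAt-updates i c)) ci→r
    ... | no j≢i = inj₁ (sym (updateAt-minimal j i c j≢i))

  chase : ∀ {k} (c : Cops n k) → EdgeDominating c → ∀ {x r} → Walk G x r →
          ¬ r ∈N[ c ] → CopWin G (x ∷ᶠ c) r
  chase c edom []                 r∉ = caught (zero , refl)
  chase c edom {x} (_∷_ {v = y} xy w) r∉ = move (y ∷ᶠ c) step (inj₂ robber)
    where
    step : ∀ j → Move G ((x ∷ᶠ c) j) ((y ∷ᶠ c) j)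
    step zero    = inj₂ xy
    step (suc j) = inj₁ refl

    robber : ∀ r′ → Move G _ r′ → CopWin G (y ∷ᶠ c) r′
    robber r′ (inj₁ refl) = chase c edom w r∉
    robber r′ (inj₂ rr′) with edom _ r′ rr′
    ... | inj₁ r∈  = ⊥-elim (r∉ r∈)
    ... | inj₂ r′∈ = capture-in-N (y ∷ᶠ c) (∈N-∷ y r′∈)

  edgeDominating⇒copsWin : ∀ {k} → Connected G → (c : Cops n k) → EdgeDominating c →
                           CopsWin G (suc k)
  edgeDominating⇒copsWin conn c edom = x ∷ᶠ c , strategy
    where
    x : Fin n
    x = Connected.nonempty conn

    strategy : ∀ r → CopWin G (x ∷ᶠ c) r
    strategy r with r ∈N[ c ]?
    ... | yes r∈ = capture-in-N (x ∷ᶠ c) (∈N-∷ x r∈)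
    ... | no r∉  = chase c edom (Connected.walk conn x r) r∉

theorem6p3 : (p : ℕ) → 2 ≤ p → {n : ℕ} (G : Graph n) → Connected G →
    ¬ InducedSubgraph (pK1+K2 p) G → CopNumber≤ G (suc p)
theorem6p3 p _ G conn free =
  let (c , edom) = edgeDominatingFamily G free (Connected.nonempty conn)
  in edgeDominating⇒copsWin G conn c edom
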